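{- Let $n$ be a positive integer with $\phi(n)=\frac{2}{3}\cdot (n+1)$, where $\phi$ is Euler's totient function. Then $n$ is square-free. -}

module Defs where

open import Data.Nat using (ℕ; suc; _*_; _≟_)
open import Data.Nat.GCD using (gcd)
open import Data.Nat.Divisibility using (_∣_)
open import Data.List using (List; length; filter; upTo; map)
open import Relation.Binary.PropositionalEquality using (_≡_)

φ : ℕ → ℕ
φ n = length (filter (λ k → gcd k n ≟ 1) (map suc (upTo n)))

SquareFree : ℕ → Set
SquareFree n = ∀ d → d * d ∣ n → d ≡ 1

-- If d ≥ 2 and d² ∣ n, write n = d·m with d ∣ m.  Being coprime to d·m is then the
-- same as being coprime to m, a condition of period m in the candidate, so
-- φ(d·m) = d·φ(m) and d ∣ φ(n).  With 3·φ(n) = 2(n + 1) this gives d ∣ 2, so d = 2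
-- and n is even.  But only odd numbers are coprime to an even number, so φ(2q) ≤ q,
-- and then 3·φ(n) ≤ 3n/2 < 2(n + 1).
module Submission where

open import Defs
open import Data.Nat using (ℕ; suc; _*_; _+_; _>_)
open import Relation.Binary.PropositionalEquality using (_≡_)

open import Data.Nat using (zero; _≤_; _<_; z≤n; s≤s; _≟_)
open import Data.Nat.GCD using (gcd)
open import Data.Nat.Properties
open import Data.Nat.Divisibility
open import Data.Nat.Coprimality
  using (Coprime; coprime?; coprime-+; coprime-divisor; coprime⇒gcd≡1; gcd≡1⇒coprime)
open import Data.List using (length; filter; map; upTo; applyUpTo; _∷_; [])
open import Data.List.Properties using (map-upTo)
open import Data.Product using (_,_)
open import Function using (_∘_)
open import Relation.Nullary using (yes; no; ¬_; ¬?; contradiction)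
open import Relation.Unary using (Pred; Decidable)
open import Relation.Binary.PropositionalEquality
  using (refl; sym; trans; cong; subst; module ≡-Reasoning)
open import Level using (0ℓ)
open import Data.Nat.Tactic.RingSolver using (solve)

private
  variable
    P Q : Pred ℕ 0ℓ

count : Decidable P → ℕ → ℕ
count P? zero = 0
count P? (suc L) with P? 0
... | yes _ = suc (count (P? ∘ suc) L)
... | no  _ = count (P? ∘ suc) L

count-mono : (P? : Decidable P) (Q? : Decidable Q) →
             (∀ i → P i → Q i) → ∀ L → count P? L ≤ count Q? L
count-mono P? Q? P⊆Q zero = z≤n
count-mono P? Q? P⊆Q (suc L) with P? 0 | Q? 0
... | yes _ | yes _  = s≤s (count-mono (P? ∘ suc) (Q? ∘ suc) (P⊆Q ∘ suc) L)
... | yes p | no ¬q  = contradiction (P⊆Q 0 p) ¬q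
... | no _  | yes _  = m≤n⇒m≤1+n (count-mono (P? ∘ suc) (Q? ∘ suc) (P⊆Q ∘ suc) L)
... | no _  | no _   = count-mono (P? ∘ suc) (Q? ∘ suc) (P⊆Q ∘ suc) L

count-cong : (P? : Decidable P) (Q? : Decidable Q) →
             (∀ i → P i → Q i) → (∀ i → Q i → P i) → ∀ L → count P? L ≡ count Q? L
count-cong P? Q? P⊆Q Q⊆P L = ≤-antisym (count-mono P? Q? P⊆Q L) (count-mono Q? P? Q⊆P L)

count-+ : (P? : Decidable P) → ∀ a b → count P? (a + b) ≡ count P? a + count (P? ∘ (a +_)) b
count-+ P? zero b = refl
count-+ P? (suc a) b with P? 0
... | yes _ = cong suc (count-+ (P? ∘ suc) a b)
... | no  _ = count-+ (P? ∘ suc) a b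

count-periodic : (P? : Decidable P) → ∀ m →
                 (∀ i → P (m + i) → P i) → (∀ i → P i → P (m + i)) →
                 ∀ k → count P? (k * m) ≡ k * count P? m
count-periodic P? m shiftˡ shiftʳ zero = refl
count-periodic P? m shiftˡ shiftʳ (suc k) = begin
  count P? (m + k * m)
    ≡⟨ count-+ P? m (k * m) ⟩
  count P? m + count (P? ∘ (m +_)) (k * m)
    ≡⟨ cong (count P? m +_) (count-cong _ P? shiftˡ shiftʳ (k * m)) ⟩
  count P? m + count P? (k * m)
    ≡⟨ cong (count P? m +_) (count-periodic P? m shiftˡ shiftʳ k) ⟩
  count P? m + k * count P? m ∎
  where open ≡-Reasoning

length-filter-applyUpTo : (P? : Decidable P) (f : ℕ → ℕ) →
                          ∀ L → length (filter P? (applyUpTo f L)) ≡ count (P? ∘ f) L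
length-filter-applyUpTo P? f zero = refl
length-filter-applyUpTo P? f (suc L) with P? (f 0)
... | yes _ = cong suc (length-filter-applyUpTo P? (f ∘ suc) L)
... | no  _ = length-filter-applyUpTo P? (f ∘ suc) L

φ≡count : ∀ n → φ n ≡ count (λ i → coprime? (suc i) n) n
φ≡count n = begin
  length (filter (λ k → gcd k n ≟ 1) (map suc (upTo n)))
    ≡⟨ cong (length ∘ filter (λ k → gcd k n ≟ 1)) (map-upTo suc n) ⟩
  length (filter (λ k → gcd k n ≟ 1) (applyUpTo suc n))
    ≡⟨ length-filter-applyUpTo (λ k → gcd k n ≟ 1) suc n ⟩
  count (λ i → gcd (suc i) n ≟ 1) n
    ≡⟨ count-cong _ _ (λ _ → gcd≡1⇒coprime) (λ _ → coprime⇒gcd≡1) n ⟩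
  count (λ i → coprime? (suc i) n) n ∎
  where open ≡-Reasoning

coprime-*⇒coprime : ∀ {k} d {m} → Coprime k (d * m) → Coprime k m
coprime-*⇒coprime d c (i∣k , i∣m) = c (i∣k , ∣n⇒∣m*n d i∣m)

-- A common divisor i of k and d·m is coprime to m, so it divides d and hence m.
coprime⇒coprime-* : ∀ {k d m} → d ∣ m → Coprime k m → Coprime k (d * m)
coprime⇒coprime-* {k} {d} {m} d∣m c {i} (i∣k , i∣d*m) = c (i∣k , ∣-trans i∣d d∣m)
  where
  i∣d : i ∣ d
  i∣d = coprime-divisor (λ (j∣i , j∣m) → c (∣-trans j∣i i∣k , j∣m))
                        (subst (i ∣_) (*-comm d m) i∣d*m)

coprime-+⇒coprime : ∀ {k m} → Coprime (m + k) m → Coprime k m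
coprime-+⇒coprime c (i∣k , i∣m) = c (∣m∣n⇒∣m+n i∣m i∣k , i∣m)

φ[d*m]≡d*φ[m] : ∀ {d m} → d ∣ m → φ (d * m) ≡ d * φ m
φ[d*m]≡d*φ[m] {d} {m} d∣m = begin
  φ (d * m)
    ≡⟨ φ≡count (d * m) ⟩
  count (λ i → coprime? (suc i) (d * m)) (d * m)
    ≡⟨ count-cong _ _ (λ _ → coprime-*⇒coprime d) (λ _ → coprime⇒coprime-* d∣m) (d * m) ⟩
  count (λ i → coprime? (suc i) m) (d * m)
    ≡⟨ count-periodic _ m shiftˡ shiftʳ d ⟩
  d * count (λ i → coprime? (suc i) m) m
    ≡⟨ cong (d *_) (φ≡count m) ⟨
  d * φ m ∎
  where
  open ≡-Reasoning
  shiftˡ : ∀ i → Coprime (suc (m + i)) m → Coprime (suc i) m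
  shiftˡ i = coprime-+⇒coprime ∘ subst (λ x → Coprime x m) (sym (+-suc m i))
  shiftʳ : ∀ i → Coprime (suc i) m → Coprime (suc (m + i)) m
  shiftʳ i = subst (λ x → Coprime x m) (+-suc m i) ∘ coprime-+

d*d∣n⇒d∣φ[n] : ∀ {d n} → d * d ∣ n → d ∣ φ n
d*d∣n⇒d∣φ[n] {d} (divides-refl q) = subst (d ∣_) (sym φ[q*[d*d]]≡d*φ[q*d]) (m∣m*n (φ (q * d)))
  where
  φ[q*[d*d]]≡d*φ[q*d] : φ (q * (d * d)) ≡ d * φ (q * d)
  φ[q*[d*d]]≡d*φ[q*d] = trans (cong φ (trans (sym (*-assoc q d d)) (*-comm (q * d) d)))
                              (φ[d*m]≡d*φ[m] {d} (n∣m*n q))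

φ[q*2]≤q : ∀ q → φ (q * 2) ≤ q
φ[q*2]≤q q = begin
  φ (q * 2)                                        ≡⟨ φ≡count (q * 2) ⟩
  count (λ i → coprime? (suc i) (q * 2)) (q * 2)   ≤⟨ count-mono _ odd? coprime⇒odd (q * 2) ⟩
  count odd? (q * 2)                               ≡⟨ count-periodic odd? 2 shiftˡ shiftʳ q ⟩
  q * 1                                            ≡⟨ *-identityʳ q ⟩
  q                                                ∎
  where
  open ≤-Reasoning
  odd? : Decidable (λ i → ¬ 2 ∣ suc i)
  odd? i = ¬? (2 ∣? suc i)
  shiftˡ : ∀ i → ¬ 2 ∣ 2 + suc i → ¬ 2 ∣ suc i
  shiftˡ _ 2∤ 2∣ = 2∤ (∣m∣n⇒∣m+n ∣-refl 2∣)
  shiftʳ : ∀ i → ¬ 2 ∣ suc i → ¬ 2 ∣ 2 + suc i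
  shiftʳ _ 2∤ 2∣ = 2∤ (∣m+n∣m⇒∣n 2∣ ∣-refl)
  coprime⇒odd : ∀ i → Coprime (suc i) (q * 2) → ¬ 2 ∣ suc i
  coprime⇒odd i c 2∣1+i with c (2∣1+i , n∣m*n q)
  ... | ()

3*φ[n]≡2*[n+1]⇒¬2∣n : ∀ {n} → 3 * φ n ≡ 2 * (n + 1) → ¬ 2 ∣ n
3*φ[n]≡2*[n+1]⇒¬2∣n eq (divides-refl q) = <-irrefl refl (begin-strict
  3 * φ (q * 2)      ≤⟨ *-monoʳ-≤ 3 (φ[q*2]≤q q) ⟩
  3 * q              ≤⟨ *-monoˡ-≤ q (n≤1+n 3) ⟩
  4 * q              <⟨ m<m+n (4 * q) (s≤s z≤n) ⟩
  4 * q + 2          ≡⟨ solve (q ∷ []) ⟩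
  2 * (q * 2 + 1)    ≡⟨ eq ⟨
  3 * φ (q * 2)      ∎)
  where open ≤-Reasoning

∣2⇒∣odd⇒≡1 : ∀ {d n} → d ∣ 2 → ¬ 2 ∣ n → d ∣ n → d ≡ 1
∣2⇒∣odd⇒≡1 {zero}              0∣2 _   _   with 0∣⇒≡0 0∣2
... | ()
∣2⇒∣odd⇒≡1 {1}                 _   _   _   = refl
∣2⇒∣odd⇒≡1 {2}                 _   2∤n 2∣n = contradiction 2∣n 2∤n
∣2⇒∣odd⇒≡1 {suc (suc (suc _))} d∣2 _   _   = contradiction d∣2 (>⇒∤ (s≤s (s≤s (s≤s z≤n))))

theorem1 : (n : ℕ) → n > 0 → 3 * φ n ≡ 2 * (n + 1) → SquareFree n
theorem1 n _ eq d d*d∣n = ∣2⇒∣odd⇒≡1 d∣2 (3*φ[n]≡2*[n+1]⇒¬2∣n eq) d∣n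
  where
  d∣n : d ∣ n
  d∣n = m*n∣⇒m∣ d d d*d∣n
  d∣2*n+2 : d ∣ 2 * n + 2
  d∣2*n+2 = subst (d ∣_) (trans eq (*-distribˡ-+ 2 n 1)) (∣n⇒∣m*n 3 (d*d∣n⇒d∣φ[n] d*d∣n))
  d∣2 : d ∣ 2
  d∣2 = ∣m+n∣m⇒∣n d∣2*n+2 (∣n⇒∣m*n 2 d∣n)
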